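{- Let $H$ be a finite connected graph and write $i(H)=i_{1,1}(H)$. For each integer $p$ with $i(H)+1\le p\le |V(H)|-1$ there exists a set $S\subseteq V(H)$ with $p-i(H)+1\le |S|\le p$ such that $|N(S)-S|\le 2\,i(H)-1$.
   Context: Discrete-time immunization model with $r=s=1$. For a finite graph $H$, a protocol is a finite sequence $(A_1,\dots,A_N)$ of subsets of $V(H)$ (vertices immunized at time-step $t$); its width is $\max_i|A_i|$. At time $0$ all vertices are red. For $t\ge1$ each vertex is green, yellow or red at time $t$: if $v\in A_t$ then $v$ is green; otherwise, a vertex red or yellow at time $t-1$ is red at time $t$, and a vertex green at time $t-1$ becomes yellow at time $t$ if it has a neighbor that is red at time $t$, and stays green otherwise. The protocol clears $H$ if all vertices are green at time $N$. $i_{1,1}(H)$ is the minimum width of a protocol that clears $H$. For $S\subseteq V(H)$, $N(S)=\bigcup_{x\in S}N(x)$ is the set of vertices adjacent to some vertex of $S$. -}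

module Defs where

open import Data.Nat using (ℕ; zero; suc; _⊔_; _≤_)
open import Data.Bool using (Bool; true; false; if_then_else_; _∧_; _∨_; not; T)
open import Data.Fin using (Fin)
open import Data.Fin.Subset using (Subset; _∈_; ∣_∣)
open import Data.Vec using (Vec; lookup; tabulate)
open import Data.List using (List; []; _∷_; foldl; foldr; map)
open import Data.List.Relation.Unary.Any using (Any)
open import Data.Product using (Σ; _×_)
open import Relation.Binary.PropositionalEquality using (_≡_)

record Graph (n : ℕ) : Set where
  field
    adj   : Fin n → Fin n → Bool
    sym   : ∀ u v → adj u v ≡ adj v u
    irrefl : ∀ v → adj v v ≡ false
open Graph public

data Reach {n : ℕ} (H : Graph n) : Fin n → Fin n → Set where
  here : ∀ {v} → Reach H v v
  step : ∀ {u w v} → T (adj H u w) → Reach H w v → Reach H u v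

Connected : ∀ {n} → Graph n → Set
Connected {n} H = ∀ (u v : Fin n) → Reach H u v

anyFin : ∀ {n} → (Fin n → Bool) → Bool
anyFin {n} f = Data.Vec.foldr _ _∨_ false (tabulate f)

data Colour : Set where
  green yellow red : Colour

isGreen : Colour → Bool
isGreen green = true
isGreen _     = false

State : ℕ → Set
State n = Fin n → Colour

initial : ∀ {n} → State n
initial _ = red

-- one time step, with A the set immunized at this time step
step-state : ∀ {n} → Graph n → Subset n → State n → State n
step-state H A s v with lookup A v | isGreen (s v)
... | true  | _     = green
... | false | false = red
... | false | true  =
  if anyFin (λ w → adj H v w ∧ (not (lookup A w) ∧ not (isGreen (s w))))
  then yellow else green
  -- a neighbour w is red at time t iff w ∉ A_t and w was red/yellow at t-1

Protocol : ℕ → Set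
Protocol n = List (Subset n)

run : ∀ {n} → Graph n → Protocol n → State n
run H P = foldl (λ s A → step-state H A s) initial P

width : ∀ {n} → Protocol n → ℕ
width P = foldr _⊔_ 0 (map ∣_∣ P)

Clears : ∀ {n} → Graph n → Protocol n → Set
Clears H P = ∀ v → run H P v ≡ green

-- k = i_{1,1}(H): minimum width of a clearing protocol
IsImmNumber : ∀ {n} → Graph n → ℕ → Set
IsImmNumber {n} H k =
  Σ (Protocol n) (λ P → Clears H P × width P ≡ k) ×
  (∀ (P : Protocol n) → Clears H P → k ≤ width P)

boundary : ∀ {n} → Graph n → Subset n → Subset n
boundary H S = tabulate λ v →
  not (lookup S v) ∧ anyFin (λ x → lookup S x ∧ adj H x v)

-- Follow the protocol one time-step at a time and count non-green vertices: there are n > p of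
-- them at time 0 and none at the end, so at some step t the count drops from above p to at most
-- p.  Take S to be the red vertices at time t.  Every vertex that was not green at time t-1 is
-- red at time t or immunized at time t, so |S| > p - i; the red and yellow vertices at time t
-- are not green at time t, and those stay in the count at time t+1 unless immunized, so
-- |S| + #yellow ≤ p.  Finally a vertex outside S with a neighbour in S is either immunized at
-- time t or yellow (otherwise it would have turned yellow), so
-- |N(S) - S| ≤ i + #yellow ≤ i + (p - |S|) ≤ 2i - 1.
module Submission where

open import Defs hiding (sym)
open import Data.Nat using (ℕ; _+_; _∸_; _*_; _≤_)
open import Data.Fin.Subset using (Subset; ∣_∣)
open import Data.Product using (Σ; _×_)

open import Data.Bool using (Bool; true; false; not; _∧_)
open import Data.Fin using (Fin; zero; suc)
open import Data.Fin.Subset using (_∈_; _∉_; _⊆_; _∪_; _∩_; ⊤; ⊥; Empty; inside; outside)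
open import Data.Fin.Subset.Properties
  using (p⊆q⇒∣p∣≤∣q∣; x∈p∪q⁺; x∈p∪q⁻; x∈p∩q⁻; Empty-unique; ∣⊥∣≡0; ∣⊤∣≡n)
open import Data.List using ([]; _∷_; foldl)
open import Data.List.Membership.Propositional using () renaming (_∈_ to _∈ₗ_)
open import Data.List.Relation.Unary.Any using (here; there)
open import Data.Nat using (zero; suc; _<_; s≤s; z≤n)
open import Data.Nat.Properties
open import Data.Product using (_,_; ∃; ∃₂)
open import Data.Sum using (inj₁; inj₂)
open import Data.Vec using (_∷_; []; lookup; tabulate)
open import Data.Vec.Properties using (lookup∘tabulate; lookup⇒[]=; []=⇒lookup)
open import Function using (_∘_)
open import Relation.Binary.PropositionalEquality
open import Relation.Nullary using (¬_; yes; no; contradiction)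

private
  variable
    k : ℕ

∣p∪q∣+∣p∩q∣≡∣p∣+∣q∣ : ∀ (p q : Subset k) → ∣ p ∪ q ∣ + ∣ p ∩ q ∣ ≡ ∣ p ∣ + ∣ q ∣
∣p∪q∣+∣p∩q∣≡∣p∣+∣q∣ []            []            = refl
∣p∪q∣+∣p∩q∣≡∣p∣+∣q∣ (outside ∷ p) (outside ∷ q) = ∣p∪q∣+∣p∩q∣≡∣p∣+∣q∣ p q
∣p∪q∣+∣p∩q∣≡∣p∣+∣q∣ (inside  ∷ p) (outside ∷ q) = cong suc (∣p∪q∣+∣p∩q∣≡∣p∣+∣q∣ p q)
∣p∪q∣+∣p∩q∣≡∣p∣+∣q∣ (outside ∷ p) (inside  ∷ q) =
  trans (cong suc (∣p∪q∣+∣p∩q∣≡∣p∣+∣q∣ p q)) (sym (+-suc ∣ p ∣ ∣ q ∣))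
∣p∪q∣+∣p∩q∣≡∣p∣+∣q∣ (inside  ∷ p) (inside  ∷ q) = cong suc (begin
  ∣ p ∪ q ∣ + suc ∣ p ∩ q ∣ ≡⟨ +-suc ∣ p ∪ q ∣ ∣ p ∩ q ∣ ⟩
  suc (∣ p ∪ q ∣ + ∣ p ∩ q ∣) ≡⟨ cong suc (∣p∪q∣+∣p∩q∣≡∣p∣+∣q∣ p q) ⟩
  suc (∣ p ∣ + ∣ q ∣)         ≡⟨ +-suc ∣ p ∣ ∣ q ∣ ⟨
  ∣ p ∣ + suc ∣ q ∣           ∎)
  where open ≡-Reasoning

∣p∪q∣≤∣p∣+∣q∣ : ∀ (p q : Subset k) → ∣ p ∪ q ∣ ≤ ∣ p ∣ + ∣ q ∣
∣p∪q∣≤∣p∣+∣q∣ p q = subst (∣ p ∪ q ∣ ≤_) (∣p∪q∣+∣p∩q∣≡∣p∣+∣q∣ p q) (m≤m+n _ _)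

Empty[p∩q]⇒∣p∣+∣q∣≡∣p∪q∣ : ∀ (p q : Subset k) → Empty (p ∩ q) → ∣ p ∣ + ∣ q ∣ ≡ ∣ p ∪ q ∣
Empty[p∩q]⇒∣p∣+∣q∣≡∣p∪q∣ {k} p q p∩q-empty = begin
  ∣ p ∣ + ∣ q ∣             ≡⟨ ∣p∪q∣+∣p∩q∣≡∣p∣+∣q∣ p q ⟨
  ∣ p ∪ q ∣ + ∣ p ∩ q ∣     ≡⟨ cong (λ r → ∣ p ∪ q ∣ + ∣ r ∣) (Empty-unique p∩q-empty) ⟩
  ∣ p ∪ q ∣ + ∣ ⊥ {k} ∣     ≡⟨ cong (∣ p ∪ q ∣ +_) (∣⊥∣≡0 k) ⟩
  ∣ p ∪ q ∣ + 0             ≡⟨ +-identityʳ _ ⟩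
  ∣ p ∪ q ∣                 ∎
  where open ≡-Reasoning

∈tabulate⁺ : ∀ {f : Fin k → Bool} {x} → f x ≡ true → x ∈ tabulate f
∈tabulate⁺ {f = f} {x} fx≡true = lookup⇒[]= x (tabulate f) (trans (lookup∘tabulate f x) fx≡true)

∈tabulate⁻ : ∀ {f : Fin k → Bool} {x} → x ∈ tabulate f → f x ≡ true
∈tabulate⁻ {f = f} {x} x∈f = trans (sym (lookup∘tabulate f x)) ([]=⇒lookup x∈f)

false≢true : ¬ false ≡ true
false≢true ()

∧≡true⁻ : ∀ {a b} → a ∧ b ≡ true → a ≡ true × b ≡ true
∧≡true⁻ {true} {true} _ = refl , refl

anyFin⁺ : ∀ (f : Fin k → Bool) x → f x ≡ true → anyFin f ≡ true
anyFin⁺ f zero    fx≡true rewrite fx≡true = refl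
anyFin⁺ f (suc x) fx≡true with f zero
... | true  = refl
... | false = anyFin⁺ (f ∘ suc) x fx≡true

anyFin⁻ : ∀ (f : Fin k → Bool) → anyFin f ≡ true → ∃ λ x → f x ≡ true
anyFin⁻ {suc k} f any≡true with f zero in f0≡true
... | true  = zero , f0≡true
... | false = let x , fx≡true = anyFin⁻ (f ∘ suc) any≡true in suc x , fx≡true

isRed isYellow : Colour → Bool
isRed red = true
isRed _   = false
isYellow yellow = true
isYellow _      = false

reds yellows nonGreens : State k → Subset k
reds s      = tabulate (isRed ∘ s)
yellows s   = tabulate (isYellow ∘ s)
nonGreens s = tabulate (not ∘ isGreen ∘ s)

Empty[reds∩yellows] : ∀ (s : State k) → Empty (reds s ∩ yellows s)
Empty[reds∩yellows] s (x , x∈r∩y) =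
  let x∈r , x∈y = x∈p∩q⁻ (reds s) (yellows s) x∈r∩y
  in red∧yellow-impossible (s x) (∈tabulate⁻ x∈r) (∈tabulate⁻ x∈y)
  where
  red∧yellow-impossible : ∀ c → isRed c ≡ true → ¬ isYellow c ≡ true
  red∧yellow-impossible red    _  ()
  red∧yellow-impossible yellow () _
  red∧yellow-impossible green  () _

reds∪yellows⊆nonGreens : ∀ (s : State k) → reds s ∪ yellows s ⊆ nonGreens s
reds∪yellows⊆nonGreens s {x} x∈r∪y with x∈p∪q⁻ (reds s) (yellows s) x∈r∪y
... | inj₁ x∈r = ∈tabulate⁺ (red⇒nonGreen (s x) (∈tabulate⁻ x∈r))
  where
  red⇒nonGreen : ∀ c → isRed c ≡ true → not (isGreen c) ≡ true
  red⇒nonGreen red _ = refl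
... | inj₂ x∈y = ∈tabulate⁺ (yellow⇒nonGreen (s x) (∈tabulate⁻ x∈y))
  where
  yellow⇒nonGreen : ∀ c → isYellow c ≡ true → not (isGreen c) ≡ true
  yellow⇒nonGreen yellow _ = refl

∣reds∣+∣yellows∣≤∣nonGreens∣ : ∀ (s : State k) → ∣ reds s ∣ + ∣ yellows s ∣ ≤ ∣ nonGreens s ∣
∣reds∣+∣yellows∣≤∣nonGreens∣ s = begin
  ∣ reds s ∣ + ∣ yellows s ∣
    ≡⟨ Empty[p∩q]⇒∣p∣+∣q∣≡∣p∪q∣ (reds s) (yellows s) (Empty[reds∩yellows] s) ⟩
  ∣ reds s ∪ yellows s ∣     ≤⟨ p⊆q⇒∣p∣≤∣q∣ (reds∪yellows⊆nonGreens s) ⟩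
  ∣ nonGreens s ∣            ∎
  where open ≤-Reasoning

n≤∣nonGreens[initial]∣ : ∀ k → k ≤ ∣ nonGreens (initial {k}) ∣
n≤∣nonGreens[initial]∣ k = subst (_≤ ∣ nonGreens (initial {k}) ∣) (∣⊤∣≡n k)
  (p⊆q⇒∣p∣≤∣q∣ {p = ⊤ {k}} {q = nonGreens (initial {k})} λ _ → ∈tabulate⁺ refl)

∣nonGreens∣≡0 : ∀ (s : State k) → (∀ v → s v ≡ green) → ∣ nonGreens s ∣ ≡ 0
∣nonGreens∣≡0 {k} s all-green =
  trans (cong ∣_∣ (Empty-unique λ (v , v∈X) → green⇒¬nonGreen (all-green v) (∈tabulate⁻ v∈X)))
        (∣⊥∣≡0 k)
  where
  green⇒¬nonGreen : ∀ {c} → c ≡ green → ¬ not (isGreen c) ≡ true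
  green⇒¬nonGreen refl ()

m<n+o⇒m∸o+1≤n : ∀ {m n o} → o ≤ m → m < n + o → m ∸ o + 1 ≤ n
m<n+o⇒m∸o+1≤n {m} {n} {o} o≤m m<n+o = begin
  m ∸ o + 1   ≡⟨ +-∸-comm 1 o≤m ⟨
  m + 1 ∸ o   ≤⟨ m≤n+o⇒m∸n≤o (m + 1) o m+1≤o+n ⟩
  n           ∎
  where
  open ≤-Reasoning
  m+1≤o+n : m + 1 ≤ o + n
  m+1≤o+n = subst₂ _≤_ (+-comm 1 m) (+-comm n o) m<n+o

m+n≤o<m+p⇒p+n≤2p∸1 : ∀ {m n o p} → m + n ≤ o → o < m + p → p + n ≤ 2 * p ∸ 1
m+n≤o<m+p⇒p+n≤2p∸1 {m} {n} {o} {p} m+n≤o o<m+p = m+n≤o⇒m≤o∸n (p + n) p+n+1≤2p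
  where
  n<p : n < p
  n<p = +-cancelˡ-< m n p (≤-<-trans m+n≤o o<m+p)
  p+n+1≤2p : p + n + 1 ≤ 2 * p
  p+n+1≤2p = subst₂ _≤_ (+-comm 1 (p + n)) (cong (p +_) (sym (+-identityʳ p))) (+-monoʳ-< p n<p)

module _ {S X : Set} (step : S → X → S) (μ : S → ℕ) (t : ℕ) where

  foldl-downcrossing : ∀ s xs → t < μ s → μ (foldl step s xs) ≤ t →
    ∃₂ λ s′ x → x ∈ₗ xs × t < μ s′ × μ (step s′ x) ≤ t
  foldl-downcrossing s []       t<μs μs≤t = contradiction μs≤t (<⇒≱ t<μs)
  foldl-downcrossing s (x ∷ xs) t<μs μend≤t with μ (step s x) ≤? t
  ... | yes μ[sx]≤t = s , x , here refl , t<μs , μ[sx]≤t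
  ... | no  μ[sx]≰t =
    let s′ , x′ , x′∈xs , crossing = foldl-downcrossing (step s x) xs (≰⇒> μ[sx]≰t) μend≤t
    in s′ , x′ , there x′∈xs , crossing

∣A∣≤width : ∀ {A : Subset k} {P} → A ∈ₗ P → ∣ A ∣ ≤ width P
∣A∣≤width {P = B ∷ P} (here refl)  = m≤m⊔n ∣ B ∣ (width P)
∣A∣≤width {P = B ∷ P} (there A∈P) = ≤-trans (∣A∣≤width A∈P) (m≤n⊔m ∣ B ∣ (width P))

module Dynamics {n : ℕ} (H : Graph n) where

  advance : State n → Subset n → State n
  advance s A = step-state H A s

  turnsRed : Subset n → State n → Fin n → Bool
  turnsRed A s w = not (lookup A w) ∧ not (isGreen (s w))

  isRed-advance : ∀ s A v → isRed (advance s A v) ≡ turnsRed A s v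
  isRed-advance s A v with lookup A v | s v
  ... | true  | _      = refl
  ... | false | red    = refl
  ... | false | yellow = refl
  ... | false | green with anyFin (λ w → adj H v w ∧ turnsRed A s w)
  ...   | true  = refl
  ...   | false = refl

  advance-green⇒no-red-neighbour : ∀ s A v → lookup A v ≡ false → advance s A v ≡ green →
    anyFin (λ w → adj H v w ∧ turnsRed A s w) ≡ false
  advance-green⇒no-red-neighbour s A v v∉A v-green with lookup A v | s v
  advance-green⇒no-red-neighbour s A v ()  _       | true  | _
  advance-green⇒no-red-neighbour s A v v∉A ()      | false | red
  advance-green⇒no-red-neighbour s A v v∉A ()      | false | yellow
  advance-green⇒no-red-neighbour s A v v∉A v-green | false | green
    with anyFin (λ w → adj H v w ∧ turnsRed A s w)
  ... | false = refl
  advance-green⇒no-red-neighbour s A v v∉A ()      | false | green | true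

  ∈boundary⁻ : ∀ {S v} → v ∈ boundary H S → v ∉ S × ∃ λ x → x ∈ S × adj H x v ≡ true
  ∈boundary⁻ {S} {v} v∈∂S =
    let v∉S , hasNeighbour =
          ∧≡true⁻ (∈tabulate⁻ {f = λ v → not (lookup S v) ∧ anyFin (λ x → lookup S x ∧ adj H x v)} v∈∂S)
        x , Sx∧adj = anyFin⁻ _ hasNeighbour
        x∈S , x~v = ∧≡true⁻ Sx∧adj
    in (λ v∈S → false≢true (trans (sym (cong not ([]=⇒lookup v∈S))) v∉S))
     , x , lookup⇒[]= x S x∈S , x~v

  nonGreens⊆reds[advance]∪immunized : ∀ s A → nonGreens s ⊆ reds (advance s A) ∪ A
  nonGreens⊆reds[advance]∪immunized s A {v} v∈X with lookup A v in A[v]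
  ... | true  = x∈p∪q⁺ (inj₂ (lookup⇒[]= v A A[v]))
  ... | false = x∈p∪q⁺ (inj₁ (∈tabulate⁺ (begin
    isRed (advance s A v)                  ≡⟨ isRed-advance s A v ⟩
    not (lookup A v) ∧ not (isGreen (s v)) ≡⟨ cong₂ (λ a b → not a ∧ b) A[v] (∈tabulate⁻ v∈X) ⟩
    true                                   ∎)))
    where open ≡-Reasoning

  boundary[reds]⊆immunized∪yellows : ∀ s A →
    boundary H (reds (advance s A)) ⊆ A ∪ yellows (advance s A)
  boundary[reds]⊆immunized∪yellows s A {v} v∈∂R
    with ∈boundary⁻ v∈∂R | advance s A v in v-colour | lookup A v in A[v]
  ... | v∉R , _ | red    | _     = contradiction (∈tabulate⁺ (cong isRed v-colour)) v∉R
  ... | _       | yellow | _     = x∈p∪q⁺ (inj₂ (∈tabulate⁺ (cong isYellow v-colour)))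
  ... | _       | green  | true  = x∈p∪q⁺ (inj₁ (lookup⇒[]= v A A[v]))
  ... | _ , x , x∈R , x~v | green | false =
    contradiction
      (trans (sym (advance-green⇒no-red-neighbour s A v A[v] v-colour)) (anyFin⁺ _ x v~red-x))
      false≢true
    where
    v~red-x : adj H v x ∧ turnsRed A s x ≡ true
    v~red-x = cong₂ _∧_ (trans (Graph.sym H v x) x~v)
                        (trans (sym (isRed-advance s A x)) (∈tabulate⁻ x∈R))

  ∣nonGreens∣≤∣reds[advance]∣+∣A∣ : ∀ s A → ∣ nonGreens s ∣ ≤ ∣ reds (advance s A) ∣ + ∣ A ∣
  ∣nonGreens∣≤∣reds[advance]∣+∣A∣ s A =
    ≤-trans (p⊆q⇒∣p∣≤∣q∣ (nonGreens⊆reds[advance]∪immunized s A))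
            (∣p∪q∣≤∣p∣+∣q∣ (reds (advance s A)) A)

  ∣boundary[reds]∣≤∣A∣+∣yellows∣ : ∀ s A →
    ∣ boundary H (reds (advance s A)) ∣ ≤ ∣ A ∣ + ∣ yellows (advance s A) ∣
  ∣boundary[reds]∣≤∣A∣+∣yellows∣ s A =
    ≤-trans (p⊆q⇒∣p∣≤∣q∣ (boundary[reds]⊆immunized∪yellows s A))
            (∣p∪q∣≤∣p∣+∣q∣ A (yellows (advance s A)))

  SparseBoundary : ℕ → ℕ → Subset n → Set
  SparseBoundary w p S = (p ∸ w + 1 ≤ ∣ S ∣ × ∣ S ∣ ≤ p) × ∣ boundary H S ∣ ≤ 2 * w ∸ 1

  reds-sparse-at-downcrossing : ∀ {w p s A} → ∣ A ∣ ≤ w → w ≤ p →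
    p < ∣ nonGreens s ∣ → ∣ nonGreens (advance s A) ∣ ≤ p → SparseBoundary w p (reds (advance s A))
  reds-sparse-at-downcrossing {w} {p} {s} {A} ∣A∣≤w w≤p p<∣X∣ ∣X′∣≤p =
    (m<n+o⇒m∸o+1≤n w≤p p<r+w , m+n≤o⇒m≤o r r+y≤p) ,
    ≤-trans (∣boundary[reds]∣≤∣A∣+∣yellows∣ s A)
            (≤-trans (+-monoˡ-≤ y ∣A∣≤w) (m+n≤o<m+p⇒p+n≤2p∸1 {m = r} r+y≤p p<r+w))
    where
    r y : ℕ
    r = ∣ reds (advance s A) ∣
    y = ∣ yellows (advance s A) ∣
    r+y≤p : r + y ≤ p
    r+y≤p = ≤-trans (∣reds∣+∣yellows∣≤∣nonGreens∣ (advance s A)) ∣X′∣≤p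
    p<r+w : p < r + w
    p<r+w = <-≤-trans p<∣X∣ (≤-trans (∣nonGreens∣≤∣reds[advance]∣+∣A∣ s A) (+-monoʳ-≤ r ∣A∣≤w))

  clearing⇒sparse-boundary : ∀ {P w p} → Clears H P → width P ≤ w → w < p → p < n →
    Σ (Subset n) (SparseBoundary w p)
  clearing⇒sparse-boundary {P} {w} {p} clears width≤w w<p p<n
    with foldl-downcrossing advance (∣_∣ ∘ nonGreens) p initial P
           (<-≤-trans p<n (n≤∣nonGreens[initial]∣ n))
           (subst (_≤ p) (sym (∣nonGreens∣≡0 (run H P) clears)) z≤n)
  ... | s , A , A∈P , p<∣X∣ , ∣X′∣≤p =
    reds (advance s A) ,
    reds-sparse-at-downcrossing {s = s} {A = A} (≤-trans (∣A∣≤width A∈P) width≤w) (<⇒≤ w<p) p<∣X∣ ∣X′∣≤p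

open Dynamics using (clearing⇒sparse-boundary)

0<m≤n∸1⇒m<n : ∀ {m n} → 0 < m → m ≤ n ∸ 1 → m < n
0<m≤n∸1⇒m<n {n = zero}  () z≤n
0<m≤n∸1⇒m<n {n = suc n} _  m≤n = s≤s m≤n

theorem4p4 : ∀ (n : ℕ) (H : Graph n) → Connected H →
    ∀ (i : ℕ) → IsImmNumber H i →
    ∀ (p : ℕ) → i + 1 ≤ p → p ≤ n ∸ 1 →
    Σ (Subset n) (λ S → (p ∸ i + 1 ≤ ∣ S ∣ × ∣ S ∣ ≤ p) ×
                        ∣ boundary H S ∣ ≤ 2 * i ∸ 1)
theorem4p4 n H _ i ((P , clears , width≡i) , _) p i+1≤p p≤n∸1 =
  clearing⇒sparse-boundary H {P = P} clears (≤-reflexive width≡i) i<p p<n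
  where
  i<p : i < p
  i<p = subst (_≤ p) (+-comm i 1) i+1≤p
  p<n : p < n
  p<n = 0<m≤n∸1⇒m<n (≤-trans (s≤s z≤n) i<p) p≤n∸1
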